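{- Let $G_0$ be a group generated by two elements $x,y$ such that (1) $x^4=y^4=1$; (2) $[x,y]^2=[[x,y],x]^2=[[x,y],y]^2=1$; (3) $[[x,y],x]$ and $[[x,y],y]$ each commute with $x$ and with $y$. Then the identities (a) $yx=xy[x,y]$, (b) $[x,y]x=x[x,y][[x,y],x]$, (c) $[x,y]y=y[x,y][[x,y],y]$ hold in $G_0$, and $|G_0|\le 128$. If in addition (4) $y^2=1$, then $[[x,y],y]=1$ and $|G_0|\le 32$.
   Context: $[\sigma,\tau]=\sigma^{ -1}\tau^{ -1}\sigma\tau$. -}

module Defs where

open import Level using (Level; _⊔_)
open import Algebra.Bundles using (Group)
open import Data.Nat using (ℕ; zero; suc; _≤_)
open import Data.List using (List; length)
open import Data.List.Membership.Setoid using ()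
open import Data.List.Relation.Unary.Any using (Any)
open import Data.Product using (Σ; _×_; ∃)

module GroupNotions {c ℓ : Level} (G : Group c ℓ) where
  open Group G

  [_,_] : Carrier → Carrier → Carrier
  [ s , t ] = s ⁻¹ ∙ t ⁻¹ ∙ s ∙ t

  _^_ : Carrier → ℕ → Carrier
  g ^ zero  = ε
  g ^ suc n = g ∙ (g ^ n)

  data Word : Set where
    gen₁ gen₂ unit : Word
    _·_ : Word → Word → Word
    inv : Word → Word

  eval : Carrier → Carrier → Word → Carrier
  eval x y gen₁ = x
  eval x y gen₂ = y
  eval x y unit = ε
  eval x y (u · v) = eval x y u ∙ eval x y v
  eval x y (inv u) = (eval x y u) ⁻¹

  GeneratedBy : Carrier → Carrier → Set (c ⊔ ℓ)
  GeneratedBy x y = ∀ g → Σ Word (λ w → g ≈ eval x y w)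

  CardinalityAtMost : ℕ → Set (c ⊔ ℓ)
  CardinalityAtMost n =
    Σ (List Carrier) (λ xs → (length xs ≤ n) × (∀ g → Any (g ≈_) xs))

{-# OPTIONS --safe #-}
module Submission where

-- Write c = [x,y], d = [c,x], g = [c,y].  Every element of G₀ is a collected
-- product x^a y^b c^e d^f g^h: such products are closed under right
-- multiplication by x and y, because d and g commute with x, y, c and each
-- other, c^e x = x c^e d^e, c^e y = y c^e g^e, and collecting y^b x gives
-- x y^b c^b g^(b choose 2).  As x, y have order dividing 4 and c, d, g order
-- dividing 2, at most 4·4·2·2·2 = 128 such products are distinct.  If y² = 1,
-- then c y = x⁻¹ y x, so g = (c y)² = x⁻¹ y² x = 1 and the count drops to
-- 4·2·2·2 = 32.

open import Defs
open import Level using (Level; _⊔_)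
open import Algebra.Bundles using (Group)
open import Data.Product using (_×_; _,_; Σ; proj₁)
open import Data.Nat using (ℕ; zero; suc; _+_; _*_; _%_; _/_; NonZero)
open import Data.Nat.Properties using (≤-reflexive)
open import Data.Nat.DivMod using (m%n<n; m≡m%n+[m/n]*n)
open import Data.List using (List; []; _∷_; map; length; applyUpTo; cartesianProductWith)
open import Data.List.Properties using (length-++; length-map; length-applyUpTo)
import Data.List.Membership.Setoid.Properties as Membership
open import Relation.Binary.Definitions using (_Respects_)
open import Relation.Binary.PropositionalEquality as ≡ using (_≡_)
open import Tactic.MonoidSolver using (solve)

choose₂ : ℕ → ℕ
choose₂ zero    = 0
choose₂ (suc n) = n + choose₂ n

module GroupFacts {o ℓ : Level} (G : Group o ℓ) where
  open Group G
  open GroupNotions G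
  open import Algebra.Properties.Group G using (inverseˡ-unique; inverseʳ-unique; ε⁻¹≈ε; ⁻¹-involutive; ⁻¹-anti-homo-∙)
  open import Relation.Binary.Reasoning.Setoid setoid
  open import Data.List.Membership.Setoid setoid using (_∈_)

  ^-2 : ∀ z → z ^ 2 ≈ z ∙ z
  ^-2 z = ∙-congˡ (identityʳ z)

  ^-sucʳ : ∀ z n → z ^ suc n ≈ z ^ n ∙ z
  ^-sucʳ z zero    = trans (identityʳ z) (sym (identityˡ z))
  ^-sucʳ z (suc n) = trans (∙-congˡ (^-sucʳ z n)) (sym (assoc _ _ _))

  ^-homo-+ : ∀ z m n → z ^ (m + n) ≈ z ^ m ∙ z ^ n
  ^-homo-+ z zero    n = sym (identityˡ _)
  ^-homo-+ z (suc m) n = trans (∙-congˡ (^-homo-+ z m n)) (sym (assoc _ _ _))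

  ^-*-order : ∀ {z n} → z ^ n ≈ ε → ∀ q → z ^ (q * n) ≈ ε
  ^-*-order         zⁿ zero    = refl
  ^-*-order {z} {n} zⁿ (suc q) = begin
    z ^ (n + q * n)       ≈⟨ ^-homo-+ z n (q * n) ⟩
    z ^ n ∙ z ^ (q * n)   ≈⟨ ∙-cong zⁿ (^-*-order zⁿ q) ⟩
    ε ∙ ε                 ≈⟨ identityˡ ε ⟩
    ε                     ∎

  ^-%-order : ∀ {z n} .{{_ : NonZero n}} → z ^ n ≈ ε → ∀ k → z ^ k ≈ z ^ (k % n)
  ^-%-order {z} {n} zⁿ k = begin
    z ^ k                                 ≡⟨ ≡.cong (z ^_) (m≡m%n+[m/n]*n k n) ⟩
    z ^ (k % n + (k / n) * n)             ≈⟨ ^-homo-+ z (k % n) _ ⟩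
    z ^ (k % n) ∙ z ^ ((k / n) * n)       ≈⟨ ∙-congˡ (^-*-order zⁿ (k / n)) ⟩
    z ^ (k % n) ∙ ε                       ≈⟨ identityʳ _ ⟩
    z ^ (k % n)                           ∎

  ⁻¹≈^ : ∀ {z m} → z ^ suc m ≈ ε → z ⁻¹ ≈ z ^ m
  ⁻¹≈^ {z} {m} zᵐ⁺¹ = sym (inverseʳ-unique z (z ^ m) zᵐ⁺¹)

  Commute : Carrier → Carrier → Set ℓ
  Commute u v = u ∙ v ≈ v ∙ u

  commute-∙ʳ : ∀ {u v w} → Commute u v → Commute u w → Commute u (v ∙ w)
  commute-∙ʳ {u} {v} {w} uv uw = begin
    u ∙ (v ∙ w)  ≈⟨ solve monoid ⟩
    u ∙ v ∙ w    ≈⟨ ∙-congʳ uv ⟩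
    v ∙ u ∙ w    ≈⟨ solve monoid ⟩
    v ∙ (u ∙ w)  ≈⟨ ∙-congˡ uw ⟩
    v ∙ (w ∙ u)  ≈⟨ solve monoid ⟩
    v ∙ w ∙ u    ∎

  commute-∙ˡ : ∀ {u v w} → Commute u w → Commute v w → Commute (u ∙ v) w
  commute-∙ˡ uw vw = sym (commute-∙ʳ (sym uw) (sym vw))

  commute-⁻¹ʳ : ∀ {u v} → Commute u v → Commute u (v ⁻¹)
  commute-⁻¹ʳ {u} {v} uv = begin
    u ∙ v ⁻¹                 ≈⟨ identityˡ _ ⟨
    ε ∙ (u ∙ v ⁻¹)           ≈⟨ ∙-congʳ (inverseˡ v) ⟨
    v ⁻¹ ∙ v ∙ (u ∙ v ⁻¹)    ≈⟨ solve monoid ⟩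
    v ⁻¹ ∙ (v ∙ u) ∙ v ⁻¹    ≈⟨ ∙-congʳ (∙-congˡ uv) ⟨
    v ⁻¹ ∙ (u ∙ v) ∙ v ⁻¹    ≈⟨ solve monoid ⟩
    v ⁻¹ ∙ u ∙ (v ∙ v ⁻¹)    ≈⟨ ∙-congˡ (inverseʳ v) ⟩
    v ⁻¹ ∙ u ∙ ε             ≈⟨ identityʳ _ ⟩
    v ⁻¹ ∙ u                 ∎

  commute-^ʳ : ∀ {u v} → Commute u v → ∀ n → Commute u (v ^ n)
  commute-^ʳ uv zero    = trans (identityʳ _) (sym (identityˡ _))
  commute-^ʳ uv (suc n) = commute-∙ʳ uv (commute-^ʳ uv n)

  commute-^ˡ : ∀ {u v} → Commute u v → ∀ n → Commute (u ^ n) v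
  commute-^ˡ uv n = sym (commute-^ʳ (sym uv) n)

  commute-[,]ʳ : ∀ {u v w} → Commute u v → Commute u w → Commute u [ v , w ]
  commute-[,]ʳ uv uw = commute-∙ʳ (commute-∙ʳ (commute-∙ʳ (commute-⁻¹ʳ uv) (commute-⁻¹ʳ uw)) uv) uw

  commutator-swap : ∀ a b → b ∙ a ≈ a ∙ b ∙ [ b , a ]
  commutator-swap a b = sym (begin
    a ∙ b ∙ (b ⁻¹ ∙ a ⁻¹ ∙ b ∙ a)   ≈⟨ solve monoid ⟩
    a ∙ (b ∙ b ⁻¹) ∙ a ⁻¹ ∙ (b ∙ a)  ≈⟨ ∙-congʳ (∙-congʳ (∙-congˡ (inverseʳ b))) ⟩
    a ∙ ε ∙ a ⁻¹ ∙ (b ∙ a)           ≈⟨ solve monoid ⟩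
    a ∙ a ⁻¹ ∙ (b ∙ a)               ≈⟨ ∙-congʳ (inverseʳ a) ⟩
    ε ∙ (b ∙ a)                      ≈⟨ identityˡ _ ⟩
    b ∙ a                            ∎)

  swap-class₂ : ∀ {a b k} → a ∙ b ≈ b ∙ a ∙ k → Commute k a →
                ∀ n → a ^ n ∙ b ≈ b ∙ a ^ n ∙ k ^ n
  swap-class₂ {a} {b} {k} ab ka zero    = solve monoid
  swap-class₂ {a} {b} {k} ab ka (suc n) = begin
    a ∙ a ^ n ∙ b                  ≈⟨ solve monoid ⟩
    a ∙ (a ^ n ∙ b)                ≈⟨ ∙-congˡ (swap-class₂ ab ka n) ⟩
    a ∙ (b ∙ a ^ n ∙ k ^ n)        ≈⟨ solve monoid ⟩
    a ∙ b ∙ a ^ n ∙ k ^ n          ≈⟨ ∙-congʳ (∙-congʳ ab) ⟩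
    b ∙ a ∙ k ∙ a ^ n ∙ k ^ n      ≈⟨ solve monoid ⟩
    b ∙ a ∙ (k ∙ a ^ n) ∙ k ^ n    ≈⟨ ∙-congʳ (∙-congˡ (commute-^ʳ ka n)) ⟩
    b ∙ a ∙ (a ^ n ∙ k) ∙ k ^ n    ≈⟨ solve monoid ⟩
    b ∙ (a ∙ a ^ n) ∙ (k ∙ k ^ n)  ∎

  swap-class₃ : ∀ {a b k l} → a ∙ b ≈ b ∙ a ∙ k → k ∙ a ≈ a ∙ k ∙ l → Commute l a → Commute l k →
                ∀ n → a ^ n ∙ b ≈ b ∙ a ^ n ∙ k ^ n ∙ l ^ choose₂ n
  swap-class₃ {a} {b} {k} {l} ab ka la lk zero    = solve monoid
  swap-class₃ {a} {b} {k} {l} ab ka la lk (suc n) = begin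
    a ∙ a ^ n ∙ b
      ≈⟨ ∙-congʳ (^-sucʳ a n) ⟩
    a ^ n ∙ a ∙ b
      ≈⟨ solve monoid ⟩
    a ^ n ∙ (a ∙ b)
      ≈⟨ ∙-congˡ ab ⟩
    a ^ n ∙ (b ∙ a ∙ k)
      ≈⟨ solve monoid ⟩
    a ^ n ∙ b ∙ (a ∙ k)
      ≈⟨ ∙-congʳ (swap-class₃ ab ka la lk n) ⟩
    b ∙ a ^ n ∙ k ^ n ∙ L ∙ (a ∙ k)
      ≈⟨ solve monoid ⟩
    b ∙ a ^ n ∙ k ^ n ∙ (L ∙ a) ∙ k
      ≈⟨ ∙-congʳ (∙-congˡ (commute-^ˡ la T)) ⟩
    b ∙ a ^ n ∙ k ^ n ∙ (a ∙ L) ∙ k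
      ≈⟨ solve monoid ⟩
    b ∙ a ^ n ∙ (k ^ n ∙ a) ∙ L ∙ k
      ≈⟨ ∙-congʳ (∙-congʳ (∙-congˡ (swap-class₂ ka lk n))) ⟩
    b ∙ a ^ n ∙ (a ∙ k ^ n ∙ l ^ n) ∙ L ∙ k
      ≈⟨ solve monoid ⟩
    b ∙ (a ^ n ∙ a) ∙ k ^ n ∙ (l ^ n ∙ L ∙ k)
      ≈⟨ ∙-congˡ (commute-∙ˡ (commute-^ˡ lk n) (commute-^ˡ lk T)) ⟩
    b ∙ (a ^ n ∙ a) ∙ k ^ n ∙ (k ∙ (l ^ n ∙ L))
      ≈⟨ solve monoid ⟩
    b ∙ (a ^ n ∙ a) ∙ (k ^ n ∙ k) ∙ (l ^ n ∙ L)
      ≈⟨ ∙-cong (∙-cong (∙-congˡ (^-sucʳ a n)) (^-sucʳ k n)) (^-homo-+ l n T) ⟨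
    b ∙ a ^ suc n ∙ k ^ suc n ∙ l ^ (n + T)
      ∎
    where
    T : ℕ
    T = choose₂ n
    L : Carrier
    L = l ^ T

  involutions⇒[[x,y],y]≈ε : ∀ x y → y ∙ y ≈ ε → [ x , y ] ∙ [ x , y ] ≈ ε → [ [ x , y ] , y ] ≈ ε
  involutions⇒[[x,y],y]≈ε x y y² c² = begin
    c ⁻¹ ∙ y ⁻¹ ∙ c ∙ y                     ≈⟨ ∙-congʳ (∙-congʳ (∙-cong c⁻¹≈c y⁻¹≈y)) ⟩
    c ∙ y ∙ c ∙ y                           ≈⟨ solve monoid ⟩
    (c ∙ y) ∙ (c ∙ y)                       ≈⟨ ∙-cong cy≈x⁻¹yx cy≈x⁻¹yx ⟩
    (x ⁻¹ ∙ y ∙ x) ∙ (x ⁻¹ ∙ y ∙ x)         ≈⟨ solve monoid ⟩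
    x ⁻¹ ∙ y ∙ (x ∙ x ⁻¹) ∙ y ∙ x           ≈⟨ ∙-congʳ (∙-congʳ (∙-congˡ (inverseʳ x))) ⟩
    x ⁻¹ ∙ y ∙ ε ∙ y ∙ x                    ≈⟨ solve monoid ⟩
    x ⁻¹ ∙ (y ∙ y) ∙ x                      ≈⟨ ∙-congʳ (∙-congˡ y²) ⟩
    x ⁻¹ ∙ ε ∙ x                            ≈⟨ solve monoid ⟩
    x ⁻¹ ∙ x                                ≈⟨ inverseˡ x ⟩
    ε                                       ∎
    where
    c : Carrier
    c = [ x , y ]
    c⁻¹≈c : c ⁻¹ ≈ c
    c⁻¹≈c = sym (inverseˡ-unique c c c²)
    y⁻¹≈y : y ⁻¹ ≈ y
    y⁻¹≈y = sym (inverseˡ-unique y y y²)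
    cy≈x⁻¹yx : c ∙ y ≈ x ⁻¹ ∙ y ∙ x
    cy≈x⁻¹yx = begin
      x ⁻¹ ∙ y ⁻¹ ∙ x ∙ y ∙ y    ≈⟨ solve monoid ⟩
      x ⁻¹ ∙ y ⁻¹ ∙ x ∙ (y ∙ y)  ≈⟨ ∙-congˡ y² ⟩
      x ⁻¹ ∙ y ⁻¹ ∙ x ∙ ε        ≈⟨ identityʳ _ ⟩
      x ⁻¹ ∙ y ⁻¹ ∙ x            ≈⟨ ∙-congʳ (∙-congˡ y⁻¹≈y) ⟩
      x ⁻¹ ∙ y ∙ x               ∎

  module RightClosure {p} {P : Carrier → Set p} (P-resp : P Respects _≈_) where

    RightClosed : Carrier → Set (o ⊔ p)
    RightClosed z = ∀ {s} → P s → P (s ∙ z)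

    rightClosed-resp : ∀ {u v} → u ≈ v → RightClosed u → RightClosed v
    rightClosed-resp u≈v cu Ps = P-resp (∙-congˡ u≈v) (cu Ps)

    rightClosed-ε : RightClosed ε
    rightClosed-ε = P-resp (sym (identityʳ _))

    rightClosed-∙ : ∀ {u v} → RightClosed u → RightClosed v → RightClosed (u ∙ v)
    rightClosed-∙ cu cv Ps = P-resp (assoc _ _ _) (cv (cu Ps))

    rightClosed-^ : ∀ {z} → RightClosed z → ∀ n → RightClosed (z ^ n)
    rightClosed-^ cz zero    = rightClosed-ε
    rightClosed-^ cz (suc n) = rightClosed-∙ cz (rightClosed-^ cz n)

    rightClosed-⁻¹ : ∀ {z m} → RightClosed z → z ^ suc m ≈ ε → RightClosed (z ⁻¹)
    rightClosed-⁻¹ {m = m} cz zᵐ⁺¹ = rightClosed-resp (sym (⁻¹≈^ {m = m} zᵐ⁺¹)) (rightClosed-^ cz m)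

    module _ {x y : Carrier} (m n : ℕ) (xᵐ⁺¹ : x ^ suc m ≈ ε) (yⁿ⁺¹ : y ^ suc n ≈ ε)
             (cx : RightClosed x) (cy : RightClosed y) where

      rightClosed-eval : ∀ w → RightClosed (eval x y w) × RightClosed (eval x y w ⁻¹)
      rightClosed-eval gen₁    = cx , rightClosed-⁻¹ {m = m} cx xᵐ⁺¹
      rightClosed-eval gen₂    = cy , rightClosed-⁻¹ {m = n} cy yⁿ⁺¹
      rightClosed-eval unit    = rightClosed-ε , rightClosed-resp (sym ε⁻¹≈ε) rightClosed-ε
      rightClosed-eval (u · v) =
        let cu , cu⁻¹ = rightClosed-eval u
            cv , cv⁻¹ = rightClosed-eval v
        in rightClosed-∙ cu cv , rightClosed-resp (sym (⁻¹-anti-homo-∙ _ _)) (rightClosed-∙ cv⁻¹ cu⁻¹)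
      rightClosed-eval (inv u) =
        let cu , cu⁻¹ = rightClosed-eval u
        in cu⁻¹ , rightClosed-resp (sym (⁻¹-involutive _)) cu

      generatedBy⇒all : GeneratedBy x y → P ε → ∀ g → P g
      generatedBy⇒all gen Pε g =
        let w , g≈w = gen g
        in P-resp (trans (identityˡ _) (sym g≈w)) (proj₁ (rightClosed-eval w) Pε)

  infixl 7 _⊗_
  _⊗_ : List Carrier → List Carrier → List Carrier
  _⊗_ = cartesianProductWith _∙_

  ∈-⊗ : ∀ {u v us vs} → u ∈ us → v ∈ vs → u ∙ v ∈ us ⊗ vs
  ∈-⊗ = Membership.∈-cartesianProductWith⁺ setoid setoid setoid ∙-cong

  length-⊗ : ∀ us vs → length (us ⊗ vs) ≡ length us * length vs
  length-⊗ []       vs = ≡.refl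
  length-⊗ (u ∷ us) vs = ≡.trans (length-++ (map (u ∙_) vs))
                                 (≡.cong₂ _+_ (length-map (u ∙_) vs) (length-⊗ us vs))

  powers : Carrier → ℕ → List Carrier
  powers z n = applyUpTo (z ^_) n

  ^∈powers : ∀ {z n} .{{_ : NonZero n}} → z ^ n ≈ ε → ∀ k → z ^ k ∈ powers z n
  ^∈powers {z} {n} zⁿ k =
    Membership.∈-resp-≈ setoid (sym (^-%-order zⁿ k)) (Membership.∈-applyUpTo⁺ setoid (z ^_) (m%n<n k n))

module TwoGenerated {o ℓ : Level} (G : Group o ℓ) (x y : Group.Carrier G) where
  open Group G
  open GroupNotions G
  open GroupFacts G
  open import Relation.Binary.Reasoning.Setoid setoid

  c d g : Carrier
  c = [ x , y ]
  d = [ c , x ]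
  g = [ c , y ]

  yx≈xyc : c ^ 2 ≈ ε → y ∙ x ≈ x ∙ y ∙ c
  yx≈xyc c² = sym (begin
    x ∙ y ∙ c        ≈⟨ ∙-congʳ (commutator-swap y x) ⟩
    y ∙ x ∙ c ∙ c    ≈⟨ solve monoid ⟩
    y ∙ x ∙ (c ∙ c)  ≈⟨ ∙-congˡ (trans (sym (^-2 c)) c²) ⟩
    y ∙ x ∙ ε        ≈⟨ identityʳ _ ⟩
    y ∙ x            ∎)

  nf : ℕ → ℕ → ℕ → ℕ → ℕ → Carrier
  nf a b e f h = x ^ a ∙ y ^ b ∙ c ^ e ∙ d ^ f ∙ g ^ h

  Collected : Carrier → Set ℓ
  Collected z = Σ ℕ λ a → Σ ℕ λ b → Σ ℕ λ e → Σ ℕ λ f → Σ ℕ λ h → z ≈ nf a b e f h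

  collected-resp : Collected Respects _≈_
  collected-resp z≈z′ (a , b , e , f , h , z≈nf) = a , b , e , f , h , trans (sym z≈z′) z≈nf

  collected-ε : Collected ε
  collected-ε = 0 , 0 , 0 , 0 , 0 , solve monoid

  module Collection (c² : c ^ 2 ≈ ε) (dx : Commute d x) (dy : Commute d y)
                    (gx : Commute g x) (gy : Commute g y) where

    dc : Commute d c
    dc = commute-[,]ʳ dx dy

    gc : Commute g c
    gc = commute-[,]ʳ gx gy

    gd : Commute g d
    gd = commute-[,]ʳ gc gx

    tail-commute : ∀ {z} → Commute d z → Commute g z → ∀ f h → Commute (d ^ f ∙ g ^ h) z
    tail-commute dz gz f h = commute-∙ˡ (commute-^ˡ dz f) (commute-^ˡ gz h)

    cᵉx : ∀ e → c ^ e ∙ x ≈ x ∙ c ^ e ∙ d ^ e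
    cᵉx = swap-class₂ (commutator-swap x c) dc

    cᵉy : ∀ e → c ^ e ∙ y ≈ y ∙ c ^ e ∙ g ^ e
    cᵉy = swap-class₂ (commutator-swap y c) gc

    yᵇx : ∀ b → y ^ b ∙ x ≈ x ∙ y ^ b ∙ c ^ b ∙ g ^ choose₂ b
    yᵇx = swap-class₃ (yx≈xyc c²) (commutator-swap y c) gy gc

    nf-∙x : ∀ a b e f h → nf a b e f h ∙ x ≈ nf (suc a) b (b + e) (e + f) (choose₂ b + h)
    nf-∙x a b e f h = begin
      x ^ a ∙ y ^ b ∙ c ^ e ∙ d ^ f ∙ g ^ h ∙ x
        ≈⟨ solve monoid ⟩
      x ^ a ∙ y ^ b ∙ c ^ e ∙ (d ^ f ∙ g ^ h ∙ x)
        ≈⟨ ∙-congˡ (tail-commute dx gx f h) ⟩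
      x ^ a ∙ y ^ b ∙ c ^ e ∙ (x ∙ (d ^ f ∙ g ^ h))
        ≈⟨ solve monoid ⟩
      x ^ a ∙ y ^ b ∙ (c ^ e ∙ x) ∙ (d ^ f ∙ g ^ h)
        ≈⟨ ∙-congʳ (∙-congˡ (cᵉx e)) ⟩
      x ^ a ∙ y ^ b ∙ (x ∙ c ^ e ∙ d ^ e) ∙ (d ^ f ∙ g ^ h)
        ≈⟨ solve monoid ⟩
      x ^ a ∙ (y ^ b ∙ x) ∙ c ^ e ∙ (d ^ e ∙ d ^ f ∙ g ^ h)
        ≈⟨ ∙-congʳ (∙-congʳ (∙-congˡ (yᵇx b))) ⟩
      x ^ a ∙ (x ∙ y ^ b ∙ c ^ b ∙ g ^ choose₂ b) ∙ c ^ e ∙ (d ^ e ∙ d ^ f ∙ g ^ h)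
        ≈⟨ solve monoid ⟩
      x ^ a ∙ x ∙ y ^ b ∙ c ^ b ∙ (g ^ choose₂ b ∙ (c ^ e ∙ (d ^ e ∙ d ^ f))) ∙ g ^ h
        ≈⟨ ∙-congʳ (∙-congˡ (commute-^ˡ gcdd (choose₂ b))) ⟩
      x ^ a ∙ x ∙ y ^ b ∙ c ^ b ∙ (c ^ e ∙ (d ^ e ∙ d ^ f) ∙ g ^ choose₂ b) ∙ g ^ h
        ≈⟨ solve monoid ⟩
      x ^ a ∙ x ∙ y ^ b ∙ (c ^ b ∙ c ^ e) ∙ (d ^ e ∙ d ^ f) ∙ (g ^ choose₂ b ∙ g ^ h)
        ≈⟨ ∙-cong (∙-cong (∙-cong (∙-congʳ (^-sucʳ x a)) (^-homo-+ c b e)) (^-homo-+ d e f))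
                  (^-homo-+ g (choose₂ b) h) ⟨
      x ^ suc a ∙ y ^ b ∙ c ^ (b + e) ∙ d ^ (e + f) ∙ g ^ (choose₂ b + h)
        ∎
      where
      gcdd : Commute g (c ^ e ∙ (d ^ e ∙ d ^ f))
      gcdd = commute-∙ʳ (commute-^ʳ gc e) (commute-∙ʳ (commute-^ʳ gd e) (commute-^ʳ gd f))

    nf-∙y : ∀ a b e f h → nf a b e f h ∙ y ≈ nf a (suc b) e f (e + h)
    nf-∙y a b e f h = begin
      x ^ a ∙ y ^ b ∙ c ^ e ∙ d ^ f ∙ g ^ h ∙ y
        ≈⟨ solve monoid ⟩
      x ^ a ∙ y ^ b ∙ c ^ e ∙ (d ^ f ∙ g ^ h ∙ y)
        ≈⟨ ∙-congˡ (tail-commute dy gy f h) ⟩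
      x ^ a ∙ y ^ b ∙ c ^ e ∙ (y ∙ (d ^ f ∙ g ^ h))
        ≈⟨ solve monoid ⟩
      x ^ a ∙ y ^ b ∙ (c ^ e ∙ y) ∙ (d ^ f ∙ g ^ h)
        ≈⟨ ∙-congʳ (∙-congˡ (cᵉy e)) ⟩
      x ^ a ∙ y ^ b ∙ (y ∙ c ^ e ∙ g ^ e) ∙ (d ^ f ∙ g ^ h)
        ≈⟨ solve monoid ⟩
      x ^ a ∙ (y ^ b ∙ y) ∙ c ^ e ∙ (g ^ e ∙ d ^ f) ∙ g ^ h
        ≈⟨ ∙-congʳ (∙-congˡ (commute-^ˡ (commute-^ʳ gd f) e)) ⟩
      x ^ a ∙ (y ^ b ∙ y) ∙ c ^ e ∙ (d ^ f ∙ g ^ e) ∙ g ^ h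
        ≈⟨ solve monoid ⟩
      x ^ a ∙ (y ^ b ∙ y) ∙ c ^ e ∙ d ^ f ∙ (g ^ e ∙ g ^ h)
        ≈⟨ ∙-cong (∙-congʳ (∙-congʳ (∙-congˡ (^-sucʳ y b)))) (^-homo-+ g e h) ⟨
      x ^ a ∙ y ^ suc b ∙ c ^ e ∙ d ^ f ∙ g ^ (e + h)
        ∎

    open RightClosure collected-resp

    collected-∙x : RightClosed x
    collected-∙x (a , b , e , f , h , z≈nf) =
      suc a , b , b + e , e + f , choose₂ b + h , trans (∙-congʳ z≈nf) (nf-∙x a b e f h)

    collected-∙y : RightClosed y
    collected-∙y (a , b , e , f , h , z≈nf) =
      a , suc b , e , f , e + h , trans (∙-congʳ z≈nf) (nf-∙y a b e f h)

    all-collected : ∀ m n → GeneratedBy x y → x ^ suc m ≈ ε → y ^ suc n ≈ ε → ∀ z → Collected z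
    all-collected m n gen xᵐ⁺¹ yⁿ⁺¹ = generatedBy⇒all m n xᵐ⁺¹ yⁿ⁺¹ collected-∙x collected-∙y gen collected-ε

  normalForms : ℕ → ℕ → ℕ → ℕ → ℕ → List Carrier
  normalForms p q r s t = powers x p ⊗ powers y q ⊗ powers c r ⊗ powers d s ⊗ powers g t

  length-normalForms : ∀ p q r s t → length (normalForms p q r s t) ≡ p * q * r * s * t
  length-normalForms p q r s t =
    ∣⊗∣ (X ⊗ Y ⊗ C ⊗ D) Γ (∣⊗∣ (X ⊗ Y ⊗ C) D (∣⊗∣ (X ⊗ Y) C (∣⊗∣ X Y (∣powers∣ x p) (∣powers∣ y q))
      (∣powers∣ c r)) (∣powers∣ d s)) (∣powers∣ g t)
    where
    X Y C D Γ : List Carrier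
    X = powers x p
    Y = powers y q
    C = powers c r
    D = powers d s
    Γ = powers g t
    ∣⊗∣ : ∀ us vs {m n} → length us ≡ m → length vs ≡ n → length (us ⊗ vs) ≡ m * n
    ∣⊗∣ us vs ∣us∣ ∣vs∣ = ≡.trans (length-⊗ us vs) (≡.cong₂ _*_ ∣us∣ ∣vs∣)
    ∣powers∣ : ∀ z n → length (powers z n) ≡ n
    ∣powers∣ z = length-applyUpTo (z ^_)

  cardinalityAtMost : ∀ p q r s t .{{_ : NonZero p}} .{{_ : NonZero q}} .{{_ : NonZero r}}
                      .{{_ : NonZero s}} .{{_ : NonZero t}} →
                      (∀ z → Collected z) →
                      x ^ p ≈ ε → y ^ q ≈ ε → c ^ r ≈ ε → d ^ s ≈ ε → g ^ t ≈ ε →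
                      CardinalityAtMost (p * q * r * s * t)
  cardinalityAtMost p q r s t collected xᵖ yᑫ cʳ dˢ gᵗ =
    normalForms p q r s t , ≤-reflexive (length-normalForms p q r s t) , λ z →
      let a , b , e , f , h , z≈nf = collected z
      in Membership.∈-resp-≈ setoid (sym z≈nf)
           (∈-⊗ (∈-⊗ (∈-⊗ (∈-⊗ (^∈powers xᵖ a) (^∈powers yᑫ b)) (^∈powers cʳ e)) (^∈powers dˢ f)) (^∈powers gᵗ h))

proposition2p7 : {c ℓ : Level} (G : Group c ℓ) → let open Group G in let open GroupNotions G in
    (x y : Carrier) → GeneratedBy x y →
    x ^ 4 ≈ ε → y ^ 4 ≈ ε →
    [ x , y ] ^ 2 ≈ ε → [ [ x , y ] , x ] ^ 2 ≈ ε → [ [ x , y ] , y ] ^ 2 ≈ ε →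
    [ [ x , y ] , x ] ∙ x ≈ x ∙ [ [ x , y ] , x ] → [ [ x , y ] , x ] ∙ y ≈ y ∙ [ [ x , y ] , x ] →
    [ [ x , y ] , y ] ∙ x ≈ x ∙ [ [ x , y ] , y ] → [ [ x , y ] , y ] ∙ y ≈ y ∙ [ [ x , y ] , y ] →
    (y ∙ x ≈ x ∙ y ∙ [ x , y ])
    × ([ x , y ] ∙ x ≈ x ∙ [ x , y ] ∙ [ [ x , y ] , x ])
    × ([ x , y ] ∙ y ≈ y ∙ [ x , y ] ∙ [ [ x , y ] , y ])
    × CardinalityAtMost 128
    × (y ^ 2 ≈ ε → ([ [ x , y ] , y ] ≈ ε) × CardinalityAtMost 32)
proposition2p7 G x y gen x⁴ y⁴ c² d² g² dx dy gx gy =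
  yx≈xyc c² , commutator-swap x c , commutator-swap y c ,
  cardinalityAtMost 4 4 2 2 2 collected x⁴ y⁴ c² d² g² ,
  λ y² → g≈ε y² , cardinalityAtMost 4 2 2 2 1 collected x⁴ y² c² d² (trans (identityʳ g) (g≈ε y²))
  where
  open Group G
  open GroupNotions G
  open GroupFacts G
  open TwoGenerated G x y
  open Collection c² dx dy gx gy

  collected : ∀ z → Collected z
  collected = all-collected 3 3 gen x⁴ y⁴

  g≈ε : y ^ 2 ≈ ε → g ≈ ε
  g≈ε y² = involutions⇒[[x,y],y]≈ε x y (trans (sym (^-2 y)) y²) (trans (sym (^-2 c)) c²)
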